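{- Let $r,s$ be positive integers and let $(P,Q)$ with the associated template be one of Cases (1)–(4) below. Let $p$ be a prime with $p\equiv1\pmod s$, $n=p^2$, and let $t:\{0,1\}^{n}\to\{0,1\}$ be a doubly cyclic polymorphism of the template; let $t^\sigma$ be its transpose (defined below). Call an $s$-tuple of integers $(k_1,\dots,k_s)$ with $0\le k_i\le n$ plausible if $\sum_{i=1}^s k_i=rn$ in Cases (1),(3),(4), and $\sum_{i=1}^s k_i\le rn$ in Case (2). Then for every plausible $(k_1,\dots,k_s)$ we have $(t^\sigma\langle k_1\rangle,\dots,t^\sigma\langle k_s\rangle)\in Q$. Moreover, in Cases (1),(2),(3), $t^\sigma\langle n-k\rangle=1-t^\sigma\langle k\rangle$ for every $0\le k\le n$.
   Context: Relations: $r\text{ -in- }s=\{x\in\{0,1\}^s:\sum x_i=r\}$, $\leq\! r\text{ -in- }s=\{x:\sum x_i\le r\}$, $\text{not-all-equal- }s=\{x\in\{0,1\}^s:\sum x_i\notin\{0,s\}\}$. Cases: (1) $P=r\text{ -in- }s$, $Q=\leq\!(2r-1)\text{ -in- }s$, $1<r<s/2$, together with the disequality pair; (2) $P=\leq\! r\text{ -in- }s$, $Q=\leq\!(2r-1)\text{ -in- }s$, $s$ even, $1<r=s/2$, with disequality pair; (3) $P=r\text{ -in- }s$, $Q=\leq\!(2r-1)\text{ -in- }s$, $s$ even, $1<r=s/2$, $r$ even, with disequality pair; (4) $P=r\text{ -in- }s$, $Q=\text{not-all-equal- }s$, $s>r$, $s>2$, $r\le s/2$, $r$ even or $s$ odd,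 no disequality pair. A function $f:\{0,1\}^N\to\{0,1\}$ is a polymorphism of the template if whenever $u_1,\dots,u_N\in P$ the tuple $(f(u_1(j),\dots,u_N(j)))_{j=1}^s$ lies in $Q$, and, in Cases (1)–(3), additionally $f(1-x_1,\dots,1-x_N)=1-f(x_1,\dots,x_N)$ for all $x\in\{0,1\}^N$. Doubly cyclic: writing the $p^2$ arguments as $p$ consecutive blocks $\mathbf x_1,\dots,\mathbf x_p$ of length $p$, $t(\mathbf x_1,\dots,\mathbf x_p)=t(\mathbf y_1,\dots,\mathbf y_p)$ whenever each $\mathbf y_i$ is a cyclic shift of $\mathbf x_i$, and $t(\mathbf x_1,\dots,\mathbf x_p)=t(\mathbf x_2,\dots,\mathbf x_p,\mathbf x_1)$. The transpose: $t^\sigma(y_1,\dots,y_{p^2})=t(z_1,\dots,z_{p^2})$ with $z_{(j-1)p+i}=y_{(i-1)p+j}$ for $i,j\in[p]$. For $0\le k\le n$, $\langle k\rangle$ denotes the $n$-tuple consisting of $k$ ones followed by $n-k$ zeros, and $t^\sigma\langle k\rangle=t^\sigma(\langle k\rangle)$. -}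

module Defs where

open import Data.Bool using (Bool; true; false; not; if_then_else_)
open import Data.Nat using (ℕ; zero; suc; _+_; _*_; _∸_; _≤_; _<_; _<ᵇ_)
open import Data.Nat.DivMod using (_%_; m%n<n)
open import Data.Nat.Divisibility using (_∣_)
open import Data.Fin using (Fin; toℕ; fromℕ<; combine; quotient; remainder)
import Data.Fin as F
open import Data.Product using (_×_; Σ)
open import Data.Sum using (_⊎_)
open import Relation.Binary.PropositionalEquality using (_≡_; _≢_)
open import Relation.Nullary using (¬_)

sumF : ∀ {m} → (Fin m → ℕ) → ℕ
sumF {zero}  f = 0
sumF {suc m} f = f F.zero + sumF (λ i → f (F.suc i))

ones : ∀ {m} → (Fin m → Bool) → ℕ
ones x = sumF (λ i → if x i then 1 else 0)

rInS : (r s : ℕ) → (Fin s → Bool) → Set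
rInS r s x = ones x ≡ r

atMostRInS : (r s : ℕ) → (Fin s → Bool) → Set
atMostRInS r s x = ones x ≤ r

notAllEqual : (s : ℕ) → (Fin s → Bool) → Set
notAllEqual s x = (ones x ≢ 0) × (ones x ≢ s)

data Case (r s : ℕ) : Set where
  case1 : 1 < r → 2 * r < s → Case r s
  case2 : 2 ∣ s → 1 < r → 2 * r ≡ s → Case r s
  case3 : 2 ∣ s → 1 < r → 2 * r ≡ s → 2 ∣ r → Case r s
  case4 : r < s → 2 < s → 2 * r ≤ s → (2 ∣ r ⊎ ¬ (2 ∣ s)) → Case r s

P : ∀ {r s} → Case r s → (Fin s → Bool) → Set
P {r} {s} (case1 _ _)     = rInS r s
P {r} {s} (case2 _ _ _)   = atMostRInS r s
P {r} {s} (case3 _ _ _ _) = rInS r s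
P {r} {s} (case4 _ _ _ _) = rInS r s

Q : ∀ {r s} → Case r s → (Fin s → Bool) → Set
Q {r} {s} (case1 _ _)     = atMostRInS (2 * r ∸ 1) s
Q {r} {s} (case2 _ _ _)   = atMostRInS (2 * r ∸ 1) s
Q {r} {s} (case3 _ _ _ _) = atMostRInS (2 * r ∸ 1) s
Q {r} {s} (case4 _ _ _ _) = notAllEqual s

-- Whether the template includes the disequality pair (Cases (1)-(3)).
hasDiseq : ∀ {r s} → Case r s → Bool
hasDiseq (case4 _ _ _ _) = false
hasDiseq _               = true

-- Polymorphisms of arity N: u i is the i-th input tuple (an element of P),
-- applying f coordinatewise must give an element of Q; with the disequality
-- pair, f must moreover be self-dual.
IsPolymorphism : ∀ {r s} → Case r s → (N : ℕ) → ((Fin N → Bool) → Bool) → Set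
IsPolymorphism {r} {s} c N f =
  ((u : Fin N → Fin s → Bool) → (∀ i → P c (u i)) →
     Q c (λ j → f (λ i → u i j)))
  × (hasDiseq c ≡ true → (x : Fin N → Bool) → f (λ i → not (x i)) ≡ not (f x))

shift : ∀ {m} → ℕ → Fin m → Fin m
shift {zero}  a ()
shift {suc m} a j = fromℕ< (m%n<n (toℕ j + a) (suc m))

-- Arguments of a p²-ary function, viewed as p blocks of length p:
-- argument number combine i j (= i*p + j, 0-based) is position j of block i.
fromBlocks : ∀ p → (Fin p → Fin p → Bool) → (Fin (p * p) → Bool)
fromBlocks p g k = g (quotient {p} p k) (remainder {p} p k)

toBlocks : ∀ p → (Fin (p * p) → Bool) → (Fin p → Fin p → Bool)
toBlocks p x i j = x (combine {p} {p} i j)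

DoublyCyclic : (p : ℕ) → ((Fin (p * p) → Bool) → Bool) → Set
DoublyCyclic p t =
  ((x : Fin (p * p) → Bool) (a : Fin p → ℕ) →
     t x ≡ t (fromBlocks p (λ i j → toBlocks p x i (shift (a i) j))))
  × ((x : Fin (p * p) → Bool) →
     t x ≡ t (fromBlocks p (λ i j → toBlocks p x (shift 1 i) j)))

-- Transpose: tσ(y) = t(z) with z_{(j-1)p+i} = y_{(i-1)p+j}.
transpose : (p : ℕ) → ((Fin (p * p) → Bool) → Bool) → ((Fin (p * p) → Bool) → Bool)
transpose p t y = t (fromBlocks p (λ j i → toBlocks p y i j))

⟨_⟩ : ∀ {n} → ℕ → Fin n → Bool
⟨ k ⟩ i = toℕ i <ᵇ k

Plausible : ∀ {r s} → Case r s → (n : ℕ) → (Fin s → ℕ) → Set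
Plausible {r} c n k = (∀ i → k i ≤ n) × sumCond c
  where
  sumCond : Case _ _ → Set
  sumCond (case2 _ _ _) = sumF k ≤ r * n
  sumCond _             = sumF k ≡ r * n

-- Shifting the sequence of blocks once and then the last block once moves every argument of t
-- one step along the order in which tσ reads its arguments, so tσ is invariant under cyclic
-- rotation of its n = p² arguments (an odometer on the two base-p digits of a position).
-- Given a plausible k, rotate ⟨kⱼ⟩ so that the runs of ones of consecutive columns follow each
-- other around the n-cycle: together they wind around it r times (at most r times in Case (2)),
-- so each row of the resulting n × s staircase has exactly r (at most r) ones, lies in P, and
-- the polymorphism property puts the column values (tσ⟨kⱼ⟩)ⱼ in Q. Rotating ⟨n − k⟩ by n − k
-- gives the complement of ⟨k⟩, and self-duality yields tσ⟨n − k⟩ = ¬ tσ⟨k⟩; for this step t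
-- must respect pointwise equality of its argument, which the polymorphism property provides.
module Submission where

open import Defs
open import Data.Bool using (Bool; true; false; not; if_then_else_; T)
open import Data.Nat
open import Data.Nat.Properties
open import Data.Nat.DivMod
open import Data.Nat.Divisibility using (_∣_; n∣m*n)
open import Data.Nat.Primality using (Prime; ¬prime[0])
open import Data.Fin using (Fin; toℕ; combine; quotient; remainder)
import Data.Fin as F
open import Data.Fin.Properties using (remQuot-combine; toℕ-combine; toℕ-fromℕ<; toℕ<n)
open import Data.Product using (_×_; _,_; proj₁; proj₂)
open import Data.Empty using (⊥; ⊥-elim)
open import Function using (_∘_)
open import Relation.Binary.PropositionalEquality
open import Relation.Nullary using (yes; no)
open import Algebra.Properties.CommutativeSemigroup +-commutativeSemigroup using (interchange)

open ≡-Reasoning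

bit : Bool → ℕ
bit b = if b then 1 else 0

sumF-cong : ∀ {m} {f g : Fin m → ℕ} → (∀ i → f i ≡ g i) → sumF f ≡ sumF g
sumF-cong {zero}  f≗g = refl
sumF-cong {suc m} f≗g = cong₂ _+_ (f≗g F.zero) (sumF-cong (f≗g ∘ F.suc))

sumF-+ : ∀ {m} (f g : Fin m → ℕ) → sumF (λ i → f i + g i) ≡ sumF f + sumF g
sumF-+ {zero}  f g = refl
sumF-+ {suc m} f g = trans (cong (f F.zero + g F.zero +_) (sumF-+ (f ∘ F.suc) (g ∘ F.suc)))
                           (interchange (f F.zero) (g F.zero) _ _)

ones-cong : ∀ {m} {x y : Fin m → Bool} → (∀ i → x i ≡ y i) → ones x ≡ ones y
ones-cong x≗y = sumF-cong (cong bit ∘ x≗y)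

ones-mono : ∀ {m} (x y : Fin m → Bool) → (∀ i → x i ≡ true → y i ≡ true) → ones x ≤ ones y
ones-mono {zero}  x y x⊆y = z≤n
ones-mono {suc m} x y x⊆y with x F.zero in x₀ | y F.zero in y₀
... | true  | true  = s≤s (ones-mono _ _ (x⊆y ∘ F.suc))
... | true  | false with () ← trans (sym y₀) (x⊆y F.zero x₀)
... | false | true  = m≤n⇒m≤1+n (ones-mono _ _ (x⊆y ∘ F.suc))
... | false | false = ones-mono _ _ (x⊆y ∘ F.suc)

ones-⟨⟩ : ∀ {s} a → a ≤ s → ones {s} ⟨ a ⟩ ≡ a
ones-⟨⟩ {zero}  .zero   z≤n       = refl
ones-⟨⟩ {suc s} zero    _         = ones-⟨⟩ {s} zero z≤n
ones-⟨⟩ {suc s} (suc a) (s≤s a≤s) = cong suc (ones-⟨⟩ a a≤s)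

<⇒<ᵇ≡true : ∀ {m n} → m < n → (m <ᵇ n) ≡ true
<⇒<ᵇ≡true {zero}  {suc n} _         = refl
<⇒<ᵇ≡true {suc m} {suc n} (s≤s m<n) = <⇒<ᵇ≡true m<n

≥⇒<ᵇ≡false : ∀ {m n} → n ≤ m → (m <ᵇ n) ≡ false
≥⇒<ᵇ≡false {m}     {zero}  _         = refl
≥⇒<ᵇ≡false {suc m} {suc n} (s≤s n≤m) = ≥⇒<ᵇ≡false n≤m

<ᵇ≡true⇒< : ∀ {m n} → (m <ᵇ n) ≡ true → m < n
<ᵇ≡true⇒< {m} {n} m<ᵇn = <ᵇ⇒< m n (subst T (sym m<ᵇn) _)

prefixSum : ∀ {s} → (Fin s → ℕ) → Fin s → ℕ
prefixSum k F.zero    = 0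
prefixSum k (F.suc j) = k F.zero + prefixSum (k ∘ F.suc) j

prefixSum+≤sumF : ∀ {s} (k : Fin s → ℕ) j → prefixSum k j + k j ≤ sumF k
prefixSum+≤sumF k F.zero    = m≤m+n _ _
prefixSum+≤sumF k (F.suc j) = ≤-trans (≤-reflexive (+-assoc (k F.zero) _ _))
                                      (+-monoʳ-≤ (k F.zero) (prefixSum+≤sumF (k ∘ F.suc) j))

∸-telescope : ∀ {a b c} → c ≤ b → b ≤ a → (a ∸ b) + (b ∸ c) ≡ a ∸ c
∸-telescope {a} {b} {c} c≤b b≤a = begin
  (a ∸ b) + (b ∸ c) ≡⟨ +-∸-assoc (a ∸ b) c≤b ⟨
  (a ∸ b) + b ∸ c   ≡⟨ cong (_∸ c) (m∸n+n≡m b≤a) ⟩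
  a ∸ c             ∎

sumF-∸-telescope : ∀ {s} (g : ℕ → ℕ) → (∀ {a b} → a ≤ b → g a ≤ g b) → (k : Fin s → ℕ) (z : ℕ) →
  sumF (λ j → g (z ∸ prefixSum k j) ∸ g (z ∸ prefixSum k j ∸ k j)) ≡ g z ∸ g (z ∸ sumF k)
sumF-∸-telescope {zero}  g mono k z = sym (n∸n≡0 (g z))
sumF-∸-telescope {suc s} g mono k z = begin
  drop z k₀ + sumF (λ j → drop (z ∸ (k₀ + prefixSum k′ j)) (k′ j))
    ≡⟨ cong (drop z k₀ +_) (sumF-cong λ j → cong (λ w → drop w (k′ j)) (sym (∸-+-assoc z k₀ _))) ⟩
  drop z k₀ + sumF (λ j → drop (z ∸ k₀ ∸ prefixSum k′ j) (k′ j))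
    ≡⟨ cong (drop z k₀ +_) (sumF-∸-telescope g mono k′ (z ∸ k₀)) ⟩
  drop z k₀ + drop (z ∸ k₀) (sumF k′)
    ≡⟨ ∸-telescope (mono (m∸n≤m (z ∸ k₀) (sumF k′))) (mono (m∸n≤m z k₀)) ⟩
  g z ∸ g (z ∸ k₀ ∸ sumF k′)
    ≡⟨ cong (λ w → g z ∸ g w) (∸-+-assoc z k₀ (sumF k′)) ⟩
  drop z (k₀ + sumF k′) ∎
  where
  k₀ = k F.zero
  k′ = k ∘ F.suc
  drop : ℕ → ℕ → ℕ
  drop w a = g w ∸ g (w ∸ a)

module _ (n : ℕ) .{{_ : NonZero n}} where

  [b+qn]/n≡q : ∀ b q → b < n → (b + q * n) / n ≡ q
  [b+qn]/n≡q b q b<n = begin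
    (b + q * n) / n   ≡⟨ +-distrib-/-∣ʳ b (n∣m*n q) ⟩
    b / n + q * n / n ≡⟨ cong₂ _+_ (m<n⇒m/n≡0 b<n) (m*n/n≡m q n) ⟩
    q                 ∎

  [ρ<k]≡q∸[ρ+qn∸k]/n : ∀ ρ q k → ρ < n → k ≤ n → k ≤ ρ + q * n →
    bit (ρ <ᵇ k) ≡ q ∸ (ρ + q * n ∸ k) / n
  [ρ<k]≡q∸[ρ+qn∸k]/n ρ q k ρ<n k≤n k≤z with ρ <? k
  ... | no ρ≮k = begin
    bit (ρ <ᵇ k)              ≡⟨ cong bit (≥⇒<ᵇ≡false k≤ρ) ⟩
    0                         ≡⟨ n∸n≡0 q ⟨
    q ∸ q                     ≡⟨ cong (q ∸_) ([b+qn]/n≡q (ρ ∸ k) q (≤-<-trans (m∸n≤m ρ k) ρ<n)) ⟨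
    q ∸ (ρ ∸ k + q * n) / n   ≡⟨ cong (λ w → q ∸ w / n) (+-∸-comm (q * n) k≤ρ) ⟨
    q ∸ (ρ + q * n ∸ k) / n   ∎
    where k≤ρ = ≮⇒≥ ρ≮k
  ... | yes ρ<k = trans (cong bit (<⇒<ᵇ≡true ρ<k)) (borrow q k≤z)
    where
    borrow : ∀ q → k ≤ ρ + q * n → 1 ≡ q ∸ (ρ + q * n ∸ k) / n
    borrow zero    k≤ρ+0 = ⊥-elim (<⇒≱ ρ<k (subst (k ≤_) (+-identityʳ ρ) k≤ρ+0))
    borrow (suc q) _     = begin
      1                                ≡⟨ m+n∸n≡m 1 q ⟨
      suc q ∸ q                        ≡⟨ cong (suc q ∸_) ([b+qn]/n≡q (ρ + n ∸ k) q ρ+n∸k<n) ⟨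
      suc q ∸ (ρ + n ∸ k + q * n) / n  ≡⟨ cong (λ w → suc q ∸ w / n) (+-∸-comm (q * n) k≤ρ+n) ⟨
      suc q ∸ (ρ + n + q * n ∸ k) / n  ≡⟨ cong (λ w → suc q ∸ (w ∸ k) / n) (+-assoc ρ n (q * n)) ⟩
      suc q ∸ (ρ + suc q * n ∸ k) / n  ∎
      where
      k≤ρ+n = ≤-trans k≤n (m≤n+m n ρ)
      ρ+n∸k<n = m<n+o⇒m∸n<o (ρ + n) k (+-monoˡ-< n ρ<k)

  -- z % n < k exactly when (z - k, z] contains a multiple of n
  [z%n<k]≡z/n∸[z∸k]/n : ∀ z k → k ≤ n → k ≤ z → bit (z % n <ᵇ k) ≡ z / n ∸ (z ∸ k) / n
  [z%n<k]≡z/n∸[z∸k]/n z k k≤n k≤z =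
    subst (λ w → bit (z % n <ᵇ k) ≡ z / n ∸ (w ∸ k) / n) (sym z≡ρ+qn)
      ([ρ<k]≡q∸[ρ+qn∸k]/n (z % n) (z / n) k (m%n<n z n) k≤n (subst (k ≤_) z≡ρ+qn k≤z))
    where z≡ρ+qn = m≡m%n+[m/n]*n z n

  ones-%n<ᵇ-telescope : ∀ {s} (k : Fin s → ℕ) z → (∀ j → k j ≤ n) → sumF k ≤ z →
    ones (λ j → (z ∸ prefixSum k j) % n <ᵇ k j) ≡ z / n ∸ (z ∸ sumF k) / n
  ones-%n<ᵇ-telescope k z k≤n Σk≤z =
    trans (sumF-cong entry) (sumF-∸-telescope (_/ n) (/-monoˡ-≤ n) k z)
    where
    entry : ∀ j → bit ((z ∸ prefixSum k j) % n <ᵇ k j) ≡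
                  (z ∸ prefixSum k j) / n ∸ (z ∸ prefixSum k j ∸ k j) / n
    entry j = [z%n<k]≡z/n∸[z∸k]/n (z ∸ prefixSum k j) (k j) (k≤n j)
                (m+n≤o⇒m≤o∸n (k j) (≤-trans (≤-reflexive (+-comm (k j) (prefixSum k j)))
                                              (≤-trans (prefixSum+≤sumF k j) Σk≤z)))

  [m+[n∸k]]%n<ᵇn∸k≡not[m<ᵇk] : ∀ m k → m < n → k ≤ n →
    ((m + (n ∸ k)) % n <ᵇ n ∸ k) ≡ not (m <ᵇ k)
  [m+[n∸k]]%n<ᵇn∸k≡not[m<ᵇk] m k m<n k≤n with m <? k
  ... | yes m<k = begin
    (m + (n ∸ k)) % n <ᵇ n ∸ k ≡⟨ cong (_<ᵇ n ∸ k) (m<n⇒m%n≡m m+[n∸k]<n) ⟩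
    m + (n ∸ k) <ᵇ n ∸ k       ≡⟨ ≥⇒<ᵇ≡false (m≤n+m (n ∸ k) m) ⟩
    false                      ≡⟨ cong not (<⇒<ᵇ≡true m<k) ⟨
    not (m <ᵇ k)               ∎
    where m+[n∸k]<n = subst (m + (n ∸ k) <_) (m+[n∸m]≡n k≤n) (+-monoˡ-< (n ∸ k) m<k)
  ... | no m≮k = begin
    (m + (n ∸ k)) % n <ᵇ n ∸ k ≡⟨ cong (λ w → w % n <ᵇ n ∸ k) m+[n∸k]≡m∸k+n ⟩
    (m ∸ k + n) % n <ᵇ n ∸ k   ≡⟨ cong (_<ᵇ n ∸ k) ([m+n]%n≡m%n (m ∸ k) n) ⟩
    (m ∸ k) % n <ᵇ n ∸ k       ≡⟨ cong (_<ᵇ n ∸ k) (m<n⇒m%n≡m (≤-<-trans (m∸n≤m m k) m<n)) ⟩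
    m ∸ k <ᵇ n ∸ k             ≡⟨ <⇒<ᵇ≡true (∸-monoˡ-< m<n k≤m) ⟩
    true                       ≡⟨ cong not (≥⇒<ᵇ≡false k≤m) ⟨
    not (m <ᵇ k)               ∎
    where
    k≤m = ≮⇒≥ m≮k
    m+[n∸k]≡m∸k+n : m + (n ∸ k) ≡ m ∸ k + n
    m+[n∸k]≡m∸k+n = begin
      m + (n ∸ k)           ≡⟨ cong (_+ (n ∸ k)) (m∸n+n≡m k≤m) ⟨
      m ∸ k + k + (n ∸ k)   ≡⟨ +-assoc (m ∸ k) k (n ∸ k) ⟩
      m ∸ k + (k + (n ∸ k)) ≡⟨ cong (m ∸ k +_) (m+[n∸m]≡n k≤n) ⟩
      m ∸ k + n             ∎

module Transposition (p′ : ℕ) where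

  p : ℕ
  p = suc p′

  n : ℕ
  n = p * p

  transposed : (Fin n → Bool) → Fin n → Bool
  transposed y = fromBlocks p (λ j i → toBlocks p y i j)

  -- the position of an argument of t in the order in which tσ reads its arguments
  index : Fin n → ℕ
  index x = p * toℕ (remainder {p} p x) + toℕ (quotient {p} p x)

  index<n : ∀ x → index x < n
  index<n x = <-≤-trans (+-monoʳ-< (p * π) (toℕ<n (quotient {p} p x)))
                        (≤-trans (≤-reflexive (trans (+-comm (p * π) p) (sym (*-suc p π))))
                                 (*-monoʳ-≤ p (toℕ<n (remainder {p} p x))))
    where π = toℕ (remainder {p} p x)

  transposed-⟨⟩ : ∀ K x → transposed ⟨ K ⟩ x ≡ (index x <ᵇ K)
  transposed-⟨⟩ K x = cong (_<ᵇ K) (toℕ-combine (remainder {p} p x) (quotient {p} p x))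

  carry : ℕ → ℕ
  carry b = if b ≡ᵇ p′ then 1 else 0

  p*c+b+1≡p*[c+carry]+[b+1]%p : ∀ c b → b < p → p * c + b + 1 ≡ p * (c + carry b) + (b + 1) % p
  p*c+b+1≡p*[c+carry]+[b+1]%p c b b<p with b ≡ᵇ p′ in b≡ᵇp′
  ... | true rewrite ≡ᵇ⇒≡ b p′ (subst T (sym b≡ᵇp′) _) = begin
    p * c + p′ + 1            ≡⟨ +-assoc (p * c) p′ 1 ⟩
    p * c + (p′ + 1)          ≡⟨ cong (p * c +_) (+-comm p′ 1) ⟩
    p * c + p                 ≡⟨ +-comm (p * c) p ⟩
    p + p * c                 ≡⟨ *-suc p c ⟨
    p * suc c                 ≡⟨ cong (p *_) (+-comm 1 c) ⟩
    p * (c + 1)               ≡⟨ +-identityʳ _ ⟨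
    p * (c + 1) + 0           ≡⟨ cong (p * (c + 1) +_) (trans (cong (_% p) (+-comm p′ 1)) (n%n≡0 p)) ⟨
    p * (c + 1) + (p′ + 1) % p ∎
  ... | false = begin
    p * c + b + 1             ≡⟨ +-assoc (p * c) b 1 ⟩
    p * c + (b + 1)           ≡⟨ cong₂ (λ u v → p * u + v) (+-identityʳ c) (m<n⇒m%n≡m b+1<p) ⟨
    p * (c + 0) + (b + 1) % p ∎
    where
    b+1<p : b + 1 < p
    b+1<p = subst (_< p) (+-comm 1 b)
              (s≤s (≤∧≢⇒< (≤-pred b<p) (λ b≡p′ → subst T b≡ᵇp′ (≡⇒≡ᵇ b p′ b≡p′))))

  [p*c+b]%n≡p*[c%p]+b : ∀ c b → b < p → (p * c + b) % n ≡ p * (c % p) + b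
  [p*c+b]%n≡p*[c%p]+b c b b<p = begin
    (p * c + b) % n       ≡⟨ cong (λ w → (w + b) % n) (*-comm p c) ⟩
    (c * p + b) % n       ≡⟨ [m*n+o]%[p*n]≡[m*n]%[p*n]+o c p b<p ⟩
    c * p % n + b         ≡⟨ cong (_+ b) (m%n*o≡m*o%[n*o] c p p) ⟨
    c % p * p + b         ≡⟨ cong (_+ b) (*-comm (c % p) p) ⟩
    p * (c % p) + b       ∎

  odometer : ∀ c b → b < p → (p * c + b + 1) % n ≡ p * ((c + carry b) % p) + (b + 1) % p
  odometer c b b<p = trans (cong (_% n) (p*c+b+1≡p*[c+carry]+[b+1]%p c b b<p))
                           ([p*c+b]%n≡p*[c%p]+b (c + carry b) ((b + 1) % p) (m%n<n (b + 1) p))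

  quotient-combine : ∀ (i j : Fin p) → quotient {p} p (combine i j) ≡ i
  quotient-combine i j = cong proj₁ (remQuot-combine i j)

  remainder-combine : ∀ (i j : Fin p) → remainder {p} p (combine i j) ≡ j
  remainder-combine i j = cong proj₂ (remQuot-combine i j)

  shiftBlocks : (Fin n → Bool) → Fin n → Bool
  shiftBlocks y = fromBlocks p (λ i j → toBlocks p y (shift 1 i) j)

  rotate : (Fin n → Bool) → Fin n → Bool
  rotate y = fromBlocks p (λ i j → toBlocks p (shiftBlocks y) i (shift (carry (toℕ i)) j))

  next : Fin n → Fin n
  next x = combine (shift 1 β) (shift (carry (toℕ β)) (remainder {p} p x))
    where β = quotient {p} p x

  rotate-pointwise : ∀ y x → rotate y x ≡ y (next x)
  rotate-pointwise y x =
    cong y (cong₂ combine (cong (shift 1) (quotient-combine β π′)) (remainder-combine β π′))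
    where
    β = quotient {p} p x
    π′ = shift (carry (toℕ β)) (remainder {p} p x)

  toℕ-shift : ∀ a (j : Fin p) → toℕ (shift a j) ≡ (toℕ j + a) % p
  toℕ-shift a j = toℕ-fromℕ< _

  index-next : ∀ x → index (next x) ≡ (index x + 1) % n
  index-next x = begin
    index (next x)
      ≡⟨ cong₂ (λ u v → p * toℕ u + toℕ v) (remainder-combine β′ π′) (quotient-combine β′ π′) ⟩
    p * toℕ π′ + toℕ β′
      ≡⟨ cong₂ (λ u v → p * u + v) (toℕ-shift (carry (toℕ β)) π) (toℕ-shift 1 β) ⟩
    p * ((toℕ π + carry (toℕ β)) % p) + (toℕ β + 1) % p
      ≡⟨ odometer (toℕ π) (toℕ β) (toℕ<n β) ⟨
    (index x + 1) % n ∎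
    where
    β = quotient {p} p x
    π = remainder {p} p x
    β′ = shift 1 β
    π′ = shift (carry (toℕ β)) π

  rotate^ : ℕ → (Fin n → Bool) → Fin n → Bool
  rotate^ zero    y = y
  rotate^ (suc T) y = rotate (rotate^ T y)

  next^ : ℕ → Fin n → Fin n
  next^ zero    x = x
  next^ (suc T) x = next^ T (next x)

  rotate^-pointwise : ∀ T y x → rotate^ T y x ≡ y (next^ T x)
  rotate^-pointwise zero    y x = refl
  rotate^-pointwise (suc T) y x = trans (rotate-pointwise (rotate^ T y) x) (rotate^-pointwise T y (next x))

  index-next^ : ∀ T x → index (next^ T x) ≡ (index x + T) % n
  index-next^ zero    x = sym (trans (cong (_% n) (+-identityʳ (index x))) (m<n⇒m%n≡m (index<n x)))
  index-next^ (suc T) x = begin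
    index (next^ T (next x))      ≡⟨ index-next^ T (next x) ⟩
    (index (next x) + T) % n      ≡⟨ cong (λ w → (w + T) % n) (index-next x) ⟩
    ((index x + 1) % n + T) % n   ≡⟨ %-distribˡ-+ ((index x + 1) % n) T n ⟩
    ((index x + 1) % n % n + T % n) % n ≡⟨ cong (λ w → (w + T % n) % n) (m%n%n≡m%n (index x + 1) n) ⟩
    ((index x + 1) % n + T % n) % n ≡⟨ %-distribˡ-+ (index x + 1) T n ⟨
    (index x + 1 + T) % n         ≡⟨ cong (_% n) (+-assoc (index x) 1 T) ⟩
    (index x + suc T) % n         ∎

  rotate^-transposed-⟨⟩ : ∀ T K x → rotate^ T (transposed ⟨ K ⟩) x ≡ ((index x + T) % n <ᵇ K)
  rotate^-transposed-⟨⟩ T K x = begin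
    rotate^ T (transposed ⟨ K ⟩) x    ≡⟨ rotate^-pointwise T (transposed ⟨ K ⟩) x ⟩
    transposed ⟨ K ⟩ (next^ T x)      ≡⟨ transposed-⟨⟩ K (next^ T x) ⟩
    index (next^ T x) <ᵇ K            ≡⟨ cong (_<ᵇ K) (index-next^ T x) ⟩
    (index x + T) % n <ᵇ K            ∎

  doublyCyclic⇒rotate^-invariant : ∀ {t : (Fin n → Bool) → Bool} → DoublyCyclic p t →
    ∀ T y → t y ≡ t (rotate^ T y)
  doublyCyclic⇒rotate^-invariant         dc zero    y = refl
  doublyCyclic⇒rotate^-invariant {t} dc (suc T) y = begin
    t y                                ≡⟨ doublyCyclic⇒rotate^-invariant dc T y ⟩
    t (rotate^ T y)                    ≡⟨ proj₂ dc (rotate^ T y) ⟩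
    t (shiftBlocks (rotate^ T y))      ≡⟨ proj₁ dc (shiftBlocks (rotate^ T y)) (carry ∘ toℕ) ⟩
    t (rotate (rotate^ T y))           ∎

module SelfDualPolymorphism {r s N : ℕ} (t : (Fin N → Bool) → Bool) (1≤r : 1 ≤ r) (2r≤s : 2 * r ≤ s)
  (poly : (u : Fin N → Fin s → Bool) → (∀ i → ones (u i) ≡ r) → ones (λ j → t (λ i → u i j)) ≤ 2 * r ∸ 1)
  (selfDual : (x : Fin N → Bool) → t (λ i → not (x i)) ≡ not (t x)) where

  r≤2r : r ≤ 2 * r
  r≤2r = m≤m+n r (r + 0)

  layout : Bool → Bool → Fin s → Bool
  layout a b j = if toℕ j <ᵇ r then a else (if toℕ j <ᵇ 2 * r then b else false)

  ones-layout-true-false : ones (layout true false) ≡ r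
  ones-layout-true-false = trans (ones-cong entry) (ones-⟨⟩ r (≤-trans r≤2r 2r≤s))
    where
    entry : ∀ j → layout true false j ≡ ⟨ r ⟩ j
    entry j with toℕ j <ᵇ r | toℕ j <ᵇ 2 * r
    ... | true  | _     = refl
    ... | false | true  = refl
    ... | false | false = refl

  ones-layout-false-true : ones (layout false true) ≡ r
  ones-layout-false-true = +-cancelˡ-≡ r _ _ (begin
    r + ones (layout false true)
      ≡⟨ cong (_+ ones (layout false true)) (ones-⟨⟩ r (≤-trans r≤2r 2r≤s)) ⟨
    ones {s} ⟨ r ⟩ + ones (layout false true)
      ≡⟨ sumF-+ (bit ∘ ⟨ r ⟩) (bit ∘ layout false true) ⟨
    sumF (λ j → bit (⟨ r ⟩ j) + bit (layout false true j))
      ≡⟨ sumF-cong entry ⟨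
    ones {s} ⟨ 2 * r ⟩
      ≡⟨ ones-⟨⟩ (2 * r) 2r≤s ⟩
    r + (r + 0)
      ≡⟨ cong (r +_) (+-identityʳ r) ⟩
    r + r ∎)
    where
    entry : ∀ j → bit (⟨ 2 * r ⟩ j) ≡ bit (⟨ r ⟩ j) + bit (layout false true j)
    entry j with toℕ j <ᵇ r in j<ᵇr | toℕ j <ᵇ 2 * r in j<ᵇ2r
    ... | true  | true  = refl
    ... | true  | false with () ← trans (sym j<ᵇ2r) (<⇒<ᵇ≡true (<-≤-trans (<ᵇ≡true⇒< j<ᵇr) r≤2r))
    ... | false | true  = refl
    ... | false | false = refl

  ones-layout-complementary : ∀ b → ones (layout b (not b)) ≡ r
  ones-layout-complementary true  = ones-layout-true-false
  ones-layout-complementary false = ones-layout-false-true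

  -- r rows A followed by r rows ¬A′ would give 2r > 2r - 1 true outputs
  no-disagreement : (A A′ : Fin N → Bool) → (∀ i → A i ≡ A′ i) → t A ≡ true → t A′ ≡ false → ⊥
  no-disagreement A A′ A≗A′ tA tA′ = <⇒≱ 2r∸1<2r (≤-trans 2r≤outputs (poly u rows))
    where
    u : Fin N → Fin s → Bool
    u i = layout (A i) (not (A′ i))
    rows : ∀ i → ones (u i) ≡ r
    rows i = trans (ones-cong λ j → cong (λ a → layout (A i) (not a) j) (sym (A≗A′ i)))
                   (ones-layout-complementary (A i))
    output : ∀ j → ⟨ 2 * r ⟩ j ≡ true → t (λ i → u i j) ≡ true
    output j j<2r with toℕ j <ᵇ r | toℕ j <ᵇ 2 * r
    ... | true  | _     = tA
    ... | false | true  = trans (selfDual A′) (cong not tA′)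
    ... | false | false with () ← j<2r
    2r≤outputs : 2 * r ≤ ones (λ j → t (λ i → u i j))
    2r≤outputs = subst (_≤ ones (λ j → t (λ i → u i j))) (ones-⟨⟩ (2 * r) 2r≤s) (ones-mono _ _ output)
    2r∸1<2r : 2 * r ∸ 1 < 2 * r
    2r∸1<2r = ∸-monoʳ-< {2 * r} {1} {0} z<s (≤-trans 1≤r r≤2r)

  respects-≗ : (A A′ : Fin N → Bool) → (∀ i → A i ≡ A′ i) → t A ≡ t A′
  respects-≗ A A′ A≗A′ with t A in tA | t A′ in tA′
  ... | true  | true  = refl
  ... | false | false = refl
  ... | true  | false = ⊥-elim (no-disagreement A A′ A≗A′ tA tA′)
  ... | false | true  = ⊥-elim (no-disagreement A′ A (sym ∘ A≗A′) tA′ tA)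

polymorphism-respects-≗ : ∀ {r s N} (c : Case r s) {t : (Fin N → Bool) → Bool} →
  IsPolymorphism c N t → hasDiseq c ≡ true → (A A′ : Fin N → Bool) → (∀ i → A i ≡ A′ i) → t A ≡ t A′
polymorphism-respects-≗ (case1 1<r 2r<s) (poly , selfDual) _ =
  SelfDualPolymorphism.respects-≗ _ (<⇒≤ 1<r) (<⇒≤ 2r<s) poly (selfDual refl)
polymorphism-respects-≗ (case2 _ 1<r 2r≡s) (poly , selfDual) _ =
  SelfDualPolymorphism.respects-≗ _ (<⇒≤ 1<r) (≤-reflexive 2r≡s)
    (λ u rows → poly u (≤-reflexive ∘ rows)) (selfDual refl)
polymorphism-respects-≗ (case3 _ 1<r 2r≡s _) (poly , selfDual) _ =
  SelfDualPolymorphism.respects-≗ _ (<⇒≤ 1<r) (≤-reflexive 2r≡s) poly (selfDual refl)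
polymorphism-respects-≗ (case4 _ _ _ _) _ ()

Q-cong : ∀ {r s} (c : Case r s) {x y : Fin s → Bool} → (∀ j → x j ≡ y j) → Q c x → Q c y
Q-cong (case1 _ _)     x≗y x∈Q = subst (_≤ _) (ones-cong x≗y) x∈Q
Q-cong (case2 _ _ _)   x≗y x∈Q = subst (_≤ _) (ones-cong x≗y) x∈Q
Q-cong (case3 _ _ _ _) x≗y x∈Q = subst (_≤ _) (ones-cong x≗y) x∈Q
Q-cong (case4 _ _ _ _) x≗y (≢0 , ≢s) = (≢0 ∘ trans (ones-cong x≗y)) , (≢s ∘ trans (ones-cong x≗y))

plausible⇒sumF≤ : ∀ {r s n} (c : Case r s) {k : Fin s → ℕ} → Plausible c n k → sumF k ≤ r * n
plausible⇒sumF≤ (case1 _ _)     (_ , Σk≡rn) = ≤-reflexive Σk≡rn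
plausible⇒sumF≤ (case2 _ _ _)   (_ , Σk≤rn) = Σk≤rn
plausible⇒sumF≤ (case3 _ _ _ _) (_ , Σk≡rn) = ≤-reflexive Σk≡rn
plausible⇒sumF≤ (case4 _ _ _ _) (_ , Σk≡rn) = ≤-reflexive Σk≡rn

module _ {r n : ℕ} .{{_ : NonZero n}} where

  r∸[m+rn∸rn]/n≡r : ∀ {m σ} → σ ≡ r * n → m < n → r ∸ (m + r * n ∸ σ) / n ≡ r
  r∸[m+rn∸rn]/n≡r {m} refl m<n = begin
    r ∸ (m + r * n ∸ r * n) / n ≡⟨ cong (λ w → r ∸ w / n) (m+n∸n≡m m (r * n)) ⟩
    r ∸ m / n                   ≡⟨ cong (r ∸_) (m<n⇒m/n≡0 m<n) ⟩
    r                           ∎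

  staircase-row∈P : ∀ {s} (c : Case r s) {k : Fin s → ℕ} → Plausible c n k → ∀ {x : Fin s → Bool} {m} →
    m < n → ones x ≡ r ∸ (m + r * n ∸ sumF k) / n → P c x
  staircase-row∈P (case1 _ _)     (_ , Σk≡rn) m<n row = trans row (r∸[m+rn∸rn]/n≡r Σk≡rn m<n)
  staircase-row∈P (case2 _ _ _) {k} _ {m = m} _ row =
    ≤-trans (≤-reflexive row) (m∸n≤m r ((m + r * n ∸ sumF k) / n))
  staircase-row∈P (case3 _ _ _ _) (_ , Σk≡rn) m<n row = trans row (r∸[m+rn∸rn]/n≡r Σk≡rn m<n)
  staircase-row∈P (case4 _ _ _ _) (_ , Σk≡rn) m<n row = trans row (r∸[m+rn∸rn]/n≡r Σk≡rn m<n)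

module _ {r s : ℕ} (c : Case r s) (p′ : ℕ) {t : (Fin (suc p′ * suc p′) → Bool) → Bool}
         (poly : IsPolymorphism c (suc p′ * suc p′) t) (dc : DoublyCyclic (suc p′) t) where
  open Transposition p′

  staircase : (k : Fin s → ℕ) → Fin n → Fin s → Bool
  staircase k i j = rotate^ (r * n ∸ prefixSum k j) (transposed ⟨ k j ⟩) i

  ones-staircase : (k : Fin s → ℕ) → (∀ j → k j ≤ n) → sumF k ≤ r * n →
    ∀ i → ones (staircase k i) ≡ r ∸ (index i + r * n ∸ sumF k) / n
  ones-staircase k k≤n Σk≤rn i = begin
    ones (staircase k i)
      ≡⟨ ones-cong (λ j → rotate^-transposed-⟨⟩ (r * n ∸ prefixSum k j) (k j) i) ⟩
    ones (λ j → (index i + (r * n ∸ prefixSum k j)) % n <ᵇ k j)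
      ≡⟨ ones-cong (λ j → cong (λ w → w % n <ᵇ k j) (+-∸-assoc (index i) (prefixSum≤rn j))) ⟨
    ones (λ j → (index i + r * n ∸ prefixSum k j) % n <ᵇ k j)
      ≡⟨ ones-%n<ᵇ-telescope n k (index i + r * n) k≤n (≤-trans Σk≤rn (m≤n+m (r * n) (index i))) ⟩
    (index i + r * n) / n ∸ (index i + r * n ∸ sumF k) / n
      ≡⟨ cong (_∸ (index i + r * n ∸ sumF k) / n) ([b+qn]/n≡q n (index i) r (index<n i)) ⟩
    r ∸ (index i + r * n ∸ sumF k) / n ∎
    where
    prefixSum≤rn : ∀ j → prefixSum k j ≤ r * n
    prefixSum≤rn j = m+n≤o⇒m≤o (prefixSum k j) (≤-trans (prefixSum+≤sumF k j) Σk≤rn)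

  transpose-⟨⟩∈Q : (k : Fin s → ℕ) → Plausible c n k → Q c (λ j → transpose p t ⟨ k j ⟩)
  transpose-⟨⟩∈Q k plausible =
    Q-cong c (λ j → sym (doublyCyclic⇒rotate^-invariant dc (r * n ∸ prefixSum k j) (transposed ⟨ k j ⟩)))
      (proj₁ poly (staircase k) rows)
    where
    rows : ∀ i → P c (staircase k i)
    rows i = staircase-row∈P c plausible (index<n i)
               (ones-staircase k (proj₁ plausible) (plausible⇒sumF≤ c plausible) i)

  transpose-⟨n∸k⟩≡not : hasDiseq c ≡ true → (k : ℕ) → k ≤ n →
    transpose p t ⟨ n ∸ k ⟩ ≡ not (transpose p t ⟨ k ⟩)
  transpose-⟨n∸k⟩≡not diseq k k≤n = begin
    t (transposed ⟨ n ∸ k ⟩)                    ≡⟨ doublyCyclic⇒rotate^-invariant dc (n ∸ k) _ ⟩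
    t (rotate^ (n ∸ k) (transposed ⟨ n ∸ k ⟩))  ≡⟨ polymorphism-respects-≗ c poly diseq _ _ complement ⟩
    t (λ i → not (transposed ⟨ k ⟩ i))          ≡⟨ proj₂ poly diseq (transposed ⟨ k ⟩) ⟩
    not (t (transposed ⟨ k ⟩))                  ∎
    where
    complement : ∀ i → rotate^ (n ∸ k) (transposed ⟨ n ∸ k ⟩) i ≡ not (transposed ⟨ k ⟩ i)
    complement i = begin
      rotate^ (n ∸ k) (transposed ⟨ n ∸ k ⟩) i ≡⟨ rotate^-transposed-⟨⟩ (n ∸ k) (n ∸ k) i ⟩
      (index i + (n ∸ k)) % n <ᵇ n ∸ k        ≡⟨ [m+[n∸k]]%n<ᵇn∸k≡not[m<ᵇk] n (index i) k (index<n i) k≤n ⟩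
      not (index i <ᵇ k)                      ≡⟨ cong not (transposed-⟨⟩ k i) ⟨
      not (transposed ⟨ k ⟩ i)                ∎

lemma24 : (r s : ℕ) → 0 < r → 0 < s → (c : Case r s) →
          (p : ℕ) → Prime p → s ∣ p ∸ 1 →
          (t : (Fin (p * p) → Bool) → Bool) →
          IsPolymorphism c (p * p) t → DoublyCyclic p t →
          ((k : Fin s → ℕ) → Plausible c (p * p) k →
             Q c (λ i → transpose p t ⟨ k i ⟩))
          × (hasDiseq c ≡ true → (k : ℕ) → k ≤ p * p →
             transpose p t ⟨ p * p ∸ k ⟩ ≡ not (transpose p t ⟨ k ⟩))
lemma24 r s _ _ c zero      p-prime _ t _    _  = ⊥-elim (¬prime[0] p-prime)
lemma24 r s _ _ c (suc p′) _       _ t poly dc =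
  transpose-⟨⟩∈Q c p′ poly dc , transpose-⟨n∸k⟩≡not c p′ poly dc
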